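{- For integers $n\ge 0$ and $q\ge 0$ define the associated Motzkin numbers $$m_n^{(q)}=n!\sum_{r=0}^{\lfloor n/2\rfloor}\frac{1}{(n-2r)!\,r!\,(r+q)!},$$ and let $m_n=m_n^{(1)}$ be the Motzkin numbers. Then for every integer $n\ge 0$, $$\sum_{s=0}^{n}m_{n-s}\,m_s=2\,(n+1)\,m_n^{(2)}.$$ -}

module Defs where

open import Data.Nat as ℕ using (ℕ; zero; suc; _∸_; _!; NonZero)
open import Data.Nat.Properties using (_!≢0; m*n≢0)
open import Data.Integer using (+_)
open import Data.Rational using (ℚ; 0ℚ; _+_; _*_; _/_)

sumTo : ℕ → (ℕ → ℚ) → ℚ
sumTo zero    f = f 0
sumTo (suc n) f = sumTo n f + f (suc n)

factQuot : ℕ → ℕ → ℕ → ℕ → ℚ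
factQuot a b c d = (+ (a !)) / ((b ! ℕ.* c !) ℕ.* d !)
  where
  instance
    _ : NonZero ((b ! ℕ.* c !) ℕ.* d !)
    _ = m*n≢0 (b ! ℕ.* c !) (d !) {{m*n≢0 (b !) (c !) {{b !≢0}} {{c !≢0}}}} {{d !≢0}}

-- associated Motzkin number  m_n^{(q)} = n! Σ_{r=0}^{⌊n/2⌋} 1/((n-2r)! r! (r+q)!)
-- (n! distributed into each summand; the value is a rational number)
motzkinAssoc : ℕ → ℕ → ℚ
motzkinAssoc q n = sumTo (n ℕ./ 2) (λ r → factQuot n (n ∸ 2 ℕ.* r) r (r ℕ.+ q))

motzkin : ℕ → ℚ
motzkin n = motzkinAssoc 1 n

module Submission where

-- Let Mot n h count the paths of n up, flat or down steps from height 0 to height h that never go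
-- below 0, so that Mot n 0 is the Motzkin number m_n. Cutting a path that ends at height 1 at its
-- last visit to height 0 gives Mot (n+1) 1 = Σ_s m_s m_(n-s). Deleting the flat steps instead leaves
-- a path of up and down steps only; choosing the positions of its k steps gives
-- Mot n h = Σ_k C(n,k) Dyck k h, and the ballot formula Dyck (h+2r) h = (h+1) (h+2r)! / (r! (r+h+1)!)
-- turns this sum into n! Σ_r 1/((n-2r)! r! (r+1)!) for Mot n 0 and into 2 (n+1) m_n^(2) for Mot (n+1) 1.

open import Relation.Binary.PropositionalEquality
  using (_≡_; refl; sym; trans; cong; cong₂; subst; module ≡-Reasoning)

module PathCounting where

  open import Data.Empty using (⊥)
  open import Data.Unit using (⊤)
  open import Data.Sum using (_⊎_; inj₁; inj₂)
  open import Data.Nat using (ℕ; zero; suc; _+_; _*_; _∸_; _/_; _≤_; _<_; z≤n; s≤s; _!; ⌊_/2⌋)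
  open import Data.Nat.Properties
  open import Data.Nat.DivMod using (m/n≡1+[m∸n]/n; m/n*n≡m)
  open import Data.Nat.Combinatorics
    using (_C_; nCk≡n!/k![n-k]!; k![n∸k]!∣n!; nCk+nC[k+1]≡[n+1]C[k+1]; k>n⇒nCk≡0)
  open import Data.Nat.Solver using (module +-*-Solver)
  open +-*-Solver using (solve; _:+_; _:*_; _:=_; con)
  open import Algebra.Properties.CommutativeSemigroup +-commutativeSemigroup
    using (x∙yz≈y∙xz) renaming (interchange to +-interchange)
  open ≡-Reasoning

  ∑< : ℕ → (ℕ → ℕ) → ℕ
  ∑< zero    f = 0
  ∑< (suc n) f = ∑< n f + f n

  ∑<-cong : ∀ n {f g} → (∀ i → i < n → f i ≡ g i) → ∑< n f ≡ ∑< n g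
  ∑<-cong zero    f≗g = refl
  ∑<-cong (suc n) f≗g = cong₂ _+_ (∑<-cong n λ i i<n → f≗g i (m<n⇒m<1+n i<n)) (f≗g n (n<1+n n))

  ∑<-+ : ∀ n f g → ∑< n (λ i → f i + g i) ≡ ∑< n f + ∑< n g
  ∑<-+ zero    f g = refl
  ∑<-+ (suc n) f g = begin
    ∑< n (λ i → f i + g i) + (f n + g n) ≡⟨ cong (_+ (f n + g n)) (∑<-+ n f g) ⟩
    ∑< n f + ∑< n g + (f n + g n)         ≡⟨ +-interchange (∑< n f) (∑< n g) (f n) (g n) ⟩
    ∑< n f + f n + (∑< n g + g n)         ∎

  ∑<-distribˡ : ∀ n (f g h : ℕ → ℕ) →
    ∑< n (λ i → f i * (g i + h i)) ≡ ∑< n (λ i → f i * g i) + ∑< n (λ i → f i * h i)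
  ∑<-distribˡ n f g h =
    trans (∑<-cong n λ i _ → *-distribˡ-+ (f i) (g i) (h i))
          (∑<-+ n (λ i → f i * g i) (λ i → f i * h i))

  ∑<-distribʳ : ∀ n (f g h : ℕ → ℕ) →
    ∑< n (λ i → (f i + g i) * h i) ≡ ∑< n (λ i → f i * h i) + ∑< n (λ i → g i * h i)
  ∑<-distribʳ n f g h =
    trans (∑<-cong n λ i _ → *-distribʳ-+ (h i) (f i) (g i))
          (∑<-+ n (λ i → f i * h i) (λ i → g i * h i))

  ∑<-suc : ∀ n f → ∑< (suc n) f ≡ f 0 + ∑< n (λ i → f (suc i))
  ∑<-suc zero    f = +-comm 0 (f 0)
  ∑<-suc (suc n) f = trans (cong (_+ f (suc n)) (∑<-suc n f)) (+-assoc (f 0) _ _)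

  ∑<-evens : ∀ m g → (∀ r → g (suc (2 * r)) ≡ 0) →
    ∑< (suc (2 * m)) g ≡ ∑< (suc m) (λ r → g (2 * r))
  ∑<-evens zero    g g-odd = refl
  ∑<-evens (suc m) g g-odd = begin
    ∑< (suc (2 * suc m)) g
      ≡⟨ cong (λ k → ∑< (suc k) g) (*-suc 2 m) ⟩
    ∑< (suc (2 * m)) g + g (suc (2 * m)) + g (2 + 2 * m)
      ≡⟨ cong₂ (λ a b → a + b + g (2 + 2 * m)) (∑<-evens m g g-odd) (g-odd m) ⟩
    ∑< (suc m) (λ r → g (2 * r)) + 0 + g (2 + 2 * m)
      ≡⟨ cong₂ _+_ (+-identityʳ _) (cong g (sym (*-suc 2 m))) ⟩
    ∑< (suc m) (λ r → g (2 * r)) + g (2 * suc m) ∎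

  ⌊n/2⌋-parity : ∀ n → 2 * ⌊ n /2⌋ ≡ n ⊎ suc (2 * ⌊ n /2⌋) ≡ n
  ⌊n/2⌋-parity zero = inj₁ refl
  ⌊n/2⌋-parity (suc zero) = inj₂ refl
  ⌊n/2⌋-parity (suc (suc n)) with ⌊n/2⌋-parity n
  ... | inj₁ even = inj₁ (trans (*-suc 2 ⌊ n /2⌋) (cong (2 +_) even))
  ... | inj₂ odd  = inj₂ (trans (cong suc (*-suc 2 ⌊ n /2⌋)) (cong (2 +_) odd))

  2*⌊n/2⌋≤n : ∀ n → 2 * ⌊ n /2⌋ ≤ n
  2*⌊n/2⌋≤n n with ⌊n/2⌋-parity n
  ... | inj₁ even = ≤-reflexive even
  ... | inj₂ odd  = ≤-trans (n≤1+n _) (≤-reflexive odd)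

  ∑<-evens-⌊/2⌋ : ∀ n g → (∀ r → g (suc (2 * r)) ≡ 0) →
    ∑< (suc n) g ≡ ∑< (suc ⌊ n /2⌋) (λ r → g (2 * r))
  ∑<-evens-⌊/2⌋ n g g-odd with ⌊n/2⌋-parity n
  ... | inj₁ even = subst (λ k → ∑< (suc k) g ≡ ∑< (suc ⌊ n /2⌋) (λ r → g (2 * r))) even
                          (∑<-evens ⌊ n /2⌋ g g-odd)
  ... | inj₂ odd  = subst (λ k → ∑< (suc k) g ≡ ∑< (suc ⌊ n /2⌋) (λ r → g (2 * r))) odd (begin
    ∑< (suc (2 * ⌊ n /2⌋)) g + g (suc (2 * ⌊ n /2⌋))
      ≡⟨ cong (∑< (suc (2 * ⌊ n /2⌋)) g +_) (g-odd ⌊ n /2⌋) ⟩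
    ∑< (suc (2 * ⌊ n /2⌋)) g + 0
      ≡⟨ +-identityʳ _ ⟩
    ∑< (suc (2 * ⌊ n /2⌋)) g
      ≡⟨ ∑<-evens ⌊ n /2⌋ g g-odd ⟩
    ∑< (suc ⌊ n /2⌋) (λ r → g (2 * r)) ∎)

  n/2≡⌊n/2⌋ : ∀ n → n / 2 ≡ ⌊ n /2⌋
  n/2≡⌊n/2⌋ zero          = refl
  n/2≡⌊n/2⌋ (suc zero)    = refl
  n/2≡⌊n/2⌋ (suc (suc n)) =
    trans (m/n≡1+[m∸n]/n {suc (suc n)} {2} (s≤s (s≤s z≤n))) (cong suc (n/2≡⌊n/2⌋ n))

  ∑<-convolution-suc : ∀ n (a b : ℕ → ℕ) →
    ∑< (suc (suc n)) (λ s → a s * b (suc n ∸ s)) ≡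
    ∑< (suc n) (λ s → a s * b (suc (n ∸ s))) + a (suc n) * b 0
  ∑<-convolution-suc n a b = cong₂ _+_
    (∑<-cong (suc n) λ s s<1+n → cong (λ m → a s * b m) (+-∸-assoc 1 (≤-pred s<1+n)))
    (cong (λ m → a (suc n) * b m) (n∸n≡0 n))

  ∑<-binomial-suc : ∀ n (f : ℕ → ℕ) →
    ∑< (suc (suc n)) (λ k → (suc n C k) * f k) ≡
    ∑< (suc n) (λ k → (n C k) * f k) + ∑< (suc n) (λ k → (n C k) * f (suc k))
  ∑<-binomial-suc n f = begin
    ∑< (suc (suc n)) (λ k → (suc n C k) * f k)
      ≡⟨ ∑<-suc (suc n) (λ k → (suc n C k) * f k) ⟩
    1 * f 0 + ∑< (suc n) (λ k → (suc n C suc k) * f (suc k))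
      ≡⟨ cong (1 * f 0 +_) (∑<-cong (suc n) λ k _ →
                              cong (_* f (suc k)) (sym (nCk+nC[k+1]≡[n+1]C[k+1] n k))) ⟩
    1 * f 0 + ∑< (suc n) (λ k → (n C k + n C suc k) * f (suc k))
      ≡⟨ cong (1 * f 0 +_) (∑<-distribʳ (suc n) (n C_) (λ k → n C suc k) (λ k → f (suc k))) ⟩
    1 * f 0 + (shifted + ∑< (suc n) (λ k → (n C suc k) * f (suc k)))
      ≡⟨ x∙yz≈y∙xz (1 * f 0) shifted _ ⟩
    shifted + ((n C 0) * f 0 + ∑< (suc n) (λ k → (n C suc k) * f (suc k)))
      ≡⟨ cong (shifted +_) (sym (∑<-suc (suc n) (λ k → (n C k) * f k))) ⟩
    shifted + (∑< (suc n) (λ k → (n C k) * f k) + (n C suc n) * f (suc n))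
      ≡⟨ cong (λ c → shifted + (∑< (suc n) (λ k → (n C k) * f k) + c * f (suc n)))
              (k>n⇒nCk≡0 (n<1+n n)) ⟩
    shifted + (∑< (suc n) (λ k → (n C k) * f k) + 0)
      ≡⟨ cong (shifted +_) (+-identityʳ _) ⟩
    shifted + ∑< (suc n) (λ k → (n C k) * f k)
      ≡⟨ +-comm shifted _ ⟩
    ∑< (suc n) (λ k → (n C k) * f k) + shifted ∎
    where
    shifted : ℕ
    shifted = ∑< (suc n) (λ k → (n C k) * f (suc k))

  Mot : ℕ → ℕ → ℕ
  Mot zero    zero    = 1
  Mot zero    (suc h) = 0
  Mot (suc n) zero    = Mot n 0 + Mot n 1
  Mot (suc n) (suc h) = Mot n h + Mot n (suc h) + Mot n (suc (suc h))

  -- Dyck k h counts the paths counted by Mot k h that have no flat steps.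
  Dyck : ℕ → ℕ → ℕ
  Dyck zero    zero    = 1
  Dyck zero    (suc h) = 0
  Dyck (suc k) zero    = Dyck k 1
  Dyck (suc k) (suc h) = Dyck k h + Dyck k (suc (suc h))

  Mot-last-visit : ∀ n h → Mot (suc n) (suc h) ≡ ∑< (suc n) (λ s → Mot s 0 * Mot (n ∸ s) h)
  Mot-last-visit zero    zero    = refl
  Mot-last-visit zero    (suc h) = refl
  Mot-last-visit (suc n) h = sym (begin
    ∑< (suc (suc n)) (λ s → Mot s 0 * Mot (suc n ∸ s) h)
      ≡⟨ ∑<-convolution-suc n (λ s → Mot s 0) (λ m → Mot m h) ⟩
    ∑< (suc n) (λ s → Mot s 0 * Mot (suc (n ∸ s)) h) + Mot (suc n) 0 * Mot 0 h
      ≡⟨ split h ⟩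
    Mot (suc (suc n)) (suc h) ∎)
    where
    convolved : ℕ → ℕ
    convolved h = ∑< (suc n) (λ s → Mot s 0 * Mot (n ∸ s) h)
    split : ∀ h → ∑< (suc n) (λ s → Mot s 0 * Mot (suc (n ∸ s)) h) + Mot (suc n) 0 * Mot 0 h ≡
                  Mot (suc (suc n)) (suc h)
    split zero = begin
      ∑< (suc n) (λ s → Mot s 0 * (Mot (n ∸ s) 0 + Mot (n ∸ s) 1)) + Mot (suc n) 0 * 1
        ≡⟨ cong₂ _+_ (∑<-distribˡ (suc n) (λ s → Mot s 0) (λ s → Mot (n ∸ s) 0)
                                                         (λ s → Mot (n ∸ s) 1))
                     (*-identityʳ (Mot (suc n) 0)) ⟩
      convolved 0 + convolved 1 + Mot (suc n) 0
        ≡⟨ cong₂ (λ a b → a + b + Mot (suc n) 0) (sym (Mot-last-visit n 0)) (sym (Mot-last-visit n 1)) ⟩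
      Mot (suc n) 1 + Mot (suc n) 2 + Mot (suc n) 0
        ≡⟨ solve 3 (λ a b c → a :+ b :+ c := c :+ a :+ b) refl
                   (Mot (suc n) 1) (Mot (suc n) 2) (Mot (suc n) 0) ⟩
      Mot (suc (suc n)) 1 ∎
    split (suc h) = begin
      ∑< (suc n) (λ s → Mot s 0 * (Mot (n ∸ s) h + Mot (n ∸ s) (suc h) + Mot (n ∸ s) (suc (suc h))))
        + Mot (suc n) 0 * 0
        ≡⟨ cong₂ _+_ (∑<-distribˡ (suc n) (λ s → Mot s 0)
                                   (λ s → Mot (n ∸ s) h + Mot (n ∸ s) (suc h))
                                   (λ s → Mot (n ∸ s) (suc (suc h))))
                     (*-zeroʳ (Mot (suc n) 0)) ⟩
      ∑< (suc n) (λ s → Mot s 0 * (Mot (n ∸ s) h + Mot (n ∸ s) (suc h))) + convolved (suc (suc h)) + 0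
        ≡⟨ +-identityʳ _ ⟩
      ∑< (suc n) (λ s → Mot s 0 * (Mot (n ∸ s) h + Mot (n ∸ s) (suc h))) + convolved (suc (suc h))
        ≡⟨ cong (_+ convolved (suc (suc h)))
                (∑<-distribˡ (suc n) (λ s → Mot s 0) (λ s → Mot (n ∸ s) h)
                                                     (λ s → Mot (n ∸ s) (suc h))) ⟩
      convolved h + convolved (suc h) + convolved (suc (suc h))
        ≡⟨ sym (cong₂ _+_ (cong₂ _+_ (Mot-last-visit n h) (Mot-last-visit n (suc h)))
                           (Mot-last-visit n (suc (suc h)))) ⟩
      Mot (suc (suc n)) (suc (suc h)) ∎

  Mot≡∑C*Dyck : ∀ n h → Mot n h ≡ ∑< (suc n) (λ k → (n C k) * Dyck k h)
  Mot≡∑C*Dyck zero    zero    = refl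
  Mot≡∑C*Dyck zero    (suc h) = refl
  Mot≡∑C*Dyck (suc n) h = sym (begin
    ∑< (suc (suc n)) (λ k → (suc n C k) * Dyck k h)
      ≡⟨ ∑<-binomial-suc n (λ k → Dyck k h) ⟩
    transformed h + ∑< (suc n) (λ k → (n C k) * Dyck (suc k) h)
      ≡⟨ shift h ⟩
    Mot (suc n) h ∎)
    where
    transformed : ℕ → ℕ
    transformed h = ∑< (suc n) (λ k → (n C k) * Dyck k h)
    shift : ∀ h → transformed h + ∑< (suc n) (λ k → (n C k) * Dyck (suc k) h) ≡ Mot (suc n) h
    shift zero = sym (cong₂ _+_ (Mot≡∑C*Dyck n 0) (Mot≡∑C*Dyck n 1))
    shift (suc h) = begin
      transformed (suc h) + ∑< (suc n) (λ k → (n C k) * (Dyck k h + Dyck k (suc (suc h))))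
        ≡⟨ cong (transformed (suc h) +_)
                (∑<-distribˡ (suc n) (n C_) (λ k → Dyck k h) (λ k → Dyck k (suc (suc h)))) ⟩
      transformed (suc h) + (transformed h + transformed (suc (suc h)))
        ≡⟨ solve 3 (λ a b c → a :+ (b :+ c) := b :+ a :+ c) refl
                   (transformed (suc h)) (transformed h) (transformed (suc (suc h))) ⟩
      transformed h + transformed (suc h) + transformed (suc (suc h))
        ≡⟨ sym (cong₂ _+_ (cong₂ _+_ (Mot≡∑C*Dyck n h) (Mot≡∑C*Dyck n (suc h)))
                           (Mot≡∑C*Dyck n (suc (suc h)))) ⟩
      Mot (suc n) (suc h) ∎

  Dyck-< : ∀ {k h} → k < h → Dyck k h ≡ 0
  Dyck-< {zero}  {suc h} _ = refl
  Dyck-< {suc k} {suc h} (s≤s k<h) = cong₂ _+_ (Dyck-< k<h) (Dyck-< (m<n⇒m<1+n (m<n⇒m<1+n k<h)))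

  Dyck-diag : ∀ h → Dyck h h ≡ 1
  Dyck-diag zero    = refl
  Dyck-diag (suc h) = cong₂ _+_ (Dyck-diag h) (Dyck-< (m<n⇒m<1+n (n<1+n h)))

  Odd : ℕ → Set
  Odd zero          = ⊥
  Odd (suc zero)    = ⊤
  Odd (suc (suc n)) = Odd n

  Odd-1+2r : ∀ r → Odd (suc (2 * r))
  Odd-1+2r zero    = _
  Odd-1+2r (suc r) = subst Odd (cong suc (sym (*-suc 2 r))) (Odd-1+2r r)

  Dyck-odd : ∀ k h → Odd (h + k) → Dyck k h ≡ 0
  Dyck-odd zero    (suc h) _   = refl
  Dyck-odd (suc k) zero    odd = Dyck-odd k 1 odd
  Dyck-odd (suc k) (suc h) odd = cong₂ _+_ (Dyck-odd k h odd′) (Dyck-odd k (suc (suc h)) odd′)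
    where
    odd′ : Odd (h + k)
    odd′ = subst Odd (cong suc (+-suc h k)) odd

  Dyck-ballot : ∀ r h → Dyck (h + 2 * r) h * (r ! * (r + suc h) !) ≡ suc h * (h + 2 * r) !
  Dyck-ballot zero h rewrite +-identityʳ h | Dyck-diag h = trans (*-identityˡ _) (*-identityˡ _)
  Dyck-ballot (suc r) zero = begin
    Dyck (2 * suc r) 0 * ((suc r) ! * (suc r + 1) !)
      ≡⟨ cong (λ k → Dyck k 0 * ((suc r) ! * (suc r + 1) !)) (*-suc 2 r) ⟩
    Dyck (suc (2 * r)) 1 * ((suc r * r !) * (suc (r + 1)) !)
      ≡⟨ cong (λ m → Dyck (suc (2 * r)) 1 * ((suc r * r !) * m !)) (sym (+-suc r 1)) ⟩
    Dyck (suc (2 * r)) 1 * ((suc r * r !) * (r + 2) !)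
      ≡⟨ solve 4 (λ d s a y → d :* ((s :* a) :* y) := s :* (d :* (a :* y))) refl
               (Dyck (suc (2 * r)) 1) (suc r) (r !) ((r + 2) !) ⟩
    suc r * (Dyck (suc (2 * r)) 1 * (r ! * (r + 2) !))
      ≡⟨ cong (suc r *_) (Dyck-ballot r 1) ⟩
    suc r * (2 * (suc (2 * r)) !)
      ≡⟨ solve 2 (λ r x → (con 1 :+ r) :* (con 2 :* x) := con 1 :* ((con 2 :+ con 2 :* r) :* x)) refl
               r ((suc (2 * r)) !) ⟩
    1 * (2 + 2 * r) !
      ≡⟨ cong (λ k → 1 * k !) (sym (*-suc 2 r)) ⟩
    1 * (2 * suc r) ! ∎
  -- Dyck (k+1) (h+1) = Dyck k h + Dyck k (h+2) turns the two instances of the formula into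
  -- (r+h+3)(h+1) + (r+1)(h+3) = (h+2)(h+2r+3).
  Dyck-ballot (suc r) (suc h) = begin
    (Dyck (h + 2 * suc r) h + Dyck (h + 2 * suc r) (suc (suc h))) * ((suc r * r !) * (suc f * f !))
      ≡⟨ cong (λ k → (A + Dyck k (suc (suc h))) * ((suc r * r !) * (suc f * f !))) k-eq ⟩
    (A + B) * ((suc r * r !) * (suc f * f !))
      ≡⟨ solve 6 (λ A B r a f Y → (A :+ B) :* (((con 1 :+ r) :* a) :* ((con 1 :+ f) :* Y))
                    := (con 1 :+ f) :* (A :* (((con 1 :+ r) :* a) :* Y))
                       :+ (con 1 :+ r) :* (B :* (a :* ((con 1 :+ f) :* Y))))
               refl A B r (r !) f (f !) ⟩
    suc f * (A * ((suc r * r !) * f !)) + suc r * (B * (r ! * (suc f * f !)))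
      ≡⟨ cong₂ (λ x y → suc f * x + suc r * y)
               (from-IH-h (Dyck-ballot (suc r) h)) (from-IH-r (Dyck-ballot r (suc (suc h)))) ⟩
    suc f * (suc h * X) + suc r * ((3 + h) * X)
      ≡⟨ solve 3 (λ r h X → (con 1 :+ (r :+ (con 2 :+ h))) :* ((con 1 :+ h) :* X)
                              :+ (con 1 :+ r) :* ((con 3 :+ h) :* X)
                    := (con 2 :+ h) :* ((con 3 :+ (h :+ con 2 :* r)) :* X)) refl r h X ⟩
    suc (suc h) * ((suc (suc (suc (h + 2 * r)))) * X)
      ≡⟨ cong (λ k → suc (suc h) * (suc k) !) (sym k-eq) ⟩
    suc (suc h) * (suc (h + 2 * suc r)) ! ∎
    where
    f X A B : ℕ
    f = r + suc (suc h)
    X = (suc (suc (h + 2 * r))) !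
    A = Dyck (h + 2 * suc r) h
    B = Dyck (suc (suc (h + 2 * r))) (suc (suc h))
    k-eq : h + 2 * suc r ≡ suc (suc (h + 2 * r))
    k-eq = trans (cong (h +_) (*-suc 2 r)) (trans (+-suc h (suc (2 * r))) (cong suc (+-suc h (2 * r))))
    from-IH-h : A * ((suc r) ! * (suc r + suc h) !) ≡ suc h * (h + 2 * suc r) ! →
                A * ((suc r * r !) * f !) ≡ suc h * X
    from-IH-h ih = trans (cong (λ m → A * ((suc r * r !) * m !)) (+-suc r (suc h)))
                         (trans ih (cong (λ k → suc h * k !) k-eq))
    from-IH-r : B * (r ! * (r + suc (suc (suc h))) !) ≡ (3 + h) * X →
                B * (r ! * (suc f * f !)) ≡ (3 + h) * X
    from-IH-r ih = trans (cong (λ m → B * (r ! * m !)) (sym (+-suc r (suc (suc h))))) ih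

  Mot₀≡∑C*Dyck-even : ∀ n → Mot n 0 ≡ ∑< (suc ⌊ n /2⌋) (λ r → (n C (2 * r)) * Dyck (2 * r) 0)
  Mot₀≡∑C*Dyck-even n =
    trans (Mot≡∑C*Dyck n 0) (∑<-evens-⌊/2⌋ n (λ k → (n C k) * Dyck k 0) odd-terms)
    where
    odd-terms : ∀ r → (n C suc (2 * r)) * Dyck (suc (2 * r)) 0 ≡ 0
    odd-terms r = trans (cong ((n C suc (2 * r)) *_) (Dyck-odd (suc (2 * r)) 0 (Odd-1+2r r)))
                        (*-zeroʳ (n C suc (2 * r)))

  Mot₁≡∑C*Dyck-odd : ∀ n →
    Mot (suc n) 1 ≡ ∑< (suc ⌊ n /2⌋) (λ r → (suc n C suc (2 * r)) * Dyck (suc (2 * r)) 1)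
  Mot₁≡∑C*Dyck-odd n = begin
    Mot (suc n) 1
      ≡⟨ Mot≡∑C*Dyck (suc n) 1 ⟩
    ∑< (suc (suc n)) (λ k → (suc n C k) * Dyck k 1)
      ≡⟨ ∑<-suc (suc n) (λ k → (suc n C k) * Dyck k 1) ⟩
    ∑< (suc n) (λ k → (suc n C suc k) * Dyck (suc k) 1)
      ≡⟨ ∑<-evens-⌊/2⌋ n (λ k → (suc n C suc k) * Dyck (suc k) 1) odd-terms ⟩
    ∑< (suc ⌊ n /2⌋) (λ r → (suc n C suc (2 * r)) * Dyck (suc (2 * r)) 1) ∎
    where
    odd-terms : ∀ r → (suc n C suc (suc (2 * r))) * Dyck (suc (suc (2 * r))) 1 ≡ 0
    odd-terms r = trans (cong ((suc n C suc (suc (2 * r))) *_) (Dyck-odd (suc (suc (2 * r))) 1 (Odd-1+2r r)))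
                        (*-zeroʳ (suc n C suc (suc (2 * r))))

  nCk*k![n∸k]!≡n! : ∀ {n k} → k ≤ n → (n C k) * (k ! * (n ∸ k) !) ≡ n !
  nCk*k![n∸k]!≡n! {n} {k} k≤n =
    trans (cong (_* (k ! * (n ∸ k) !)) (nCk≡n!/k![n-k]! k≤n))
          (m/n*n≡m {{k !* (n ∸ k) !≢0}} (k![n∸k]!∣n! k≤n))

  C*Dyck*factorials≡[1+h]*m! : ∀ {m r} h → h + 2 * r ≤ m →
    (m C (h + 2 * r)) * Dyck (h + 2 * r) h * (((m ∸ (h + 2 * r)) ! * r !) * (r + suc h) !) ≡ suc h * m !
  C*Dyck*factorials≡[1+h]*m! {m} {r} h k≤m = begin
    c * d * ((a * b) * e)
      ≡⟨ solve 5 (λ c d a b e → c :* d :* ((a :* b) :* e) := (d :* (b :* e)) :* (c :* a)) refl c d a b e ⟩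
    d * (b * e) * (c * a)
      ≡⟨ cong (_* (c * a)) (Dyck-ballot r h) ⟩
    suc h * k ! * (c * a)
      ≡⟨ solve 4 (λ s x c a → s :* x :* (c :* a) := s :* (c :* (x :* a))) refl (suc h) (k !) c a ⟩
    suc h * (c * (k ! * a))
      ≡⟨ cong (suc h *_) (nCk*k![n∸k]!≡n! k≤m) ⟩
    suc h * m ! ∎
    where
    k c d a b e : ℕ
    k = h + 2 * r
    c = m C k
    d = Dyck k h
    a = (m ∸ k) !
    b = r !
    e = (r + suc h) !

open import Defs
open import Data.Nat as ℕ using (ℕ; zero; suc; _∸_; _≤_; _!; ⌊_/2⌋; NonZero; s≤s)
import Data.Nat.Properties as ℕ
open import Data.Nat.Combinatorics using (_C_)
open import Data.Integer using (+_)
import Data.Integer as ℤ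
import Data.Integer.Properties as ℤ
open import Data.Rational using (ℚ; _+_; _*_; _/_; fromℚᵘ)
open import Data.Rational.Properties
  using (toℚᵘ-injective; toℚᵘ-fromℚᵘ; toℚᵘ-homo-+; toℚᵘ-homo-*; fromℚᵘ-cong;
         *-identityˡ; *-assoc; *-comm; *-distribˡ-+)
open import Data.Rational.Unnormalised as ℚᵘ using (mkℚᵘ; *≡*)
import Data.Rational.Unnormalised.Properties as ℚᵘ
open PathCounting
open ≡-Reasoning

fromℚᵘ-homo-+ : ∀ p q → fromℚᵘ (p ℚᵘ.+ q) ≡ fromℚᵘ p + fromℚᵘ q
fromℚᵘ-homo-+ p q = toℚᵘ-injective (ℚᵘ.≃-trans (toℚᵘ-fromℚᵘ (p ℚᵘ.+ q)) (ℚᵘ.≃-sym (ℚᵘ.≃-trans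
  (toℚᵘ-homo-+ (fromℚᵘ p) (fromℚᵘ q)) (ℚᵘ.+-cong (toℚᵘ-fromℚᵘ p) (toℚᵘ-fromℚᵘ q)))))

fromℚᵘ-homo-* : ∀ p q → fromℚᵘ (p ℚᵘ.* q) ≡ fromℚᵘ p * fromℚᵘ q
fromℚᵘ-homo-* p q = toℚᵘ-injective (ℚᵘ.≃-trans (toℚᵘ-fromℚᵘ (p ℚᵘ.* q)) (ℚᵘ.≃-sym (ℚᵘ.≃-trans
  (toℚᵘ-homo-* (fromℚᵘ p) (fromℚᵘ q)) (ℚᵘ.*-cong (toℚᵘ-fromℚᵘ p) (toℚᵘ-fromℚᵘ q)))))

fromℕ : ℕ → ℚ
fromℕ n = + n / 1

fromℕ-homo-+ : ∀ m n → fromℕ (m ℕ.+ n) ≡ fromℕ m + fromℕ n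
fromℕ-homo-+ m n =
  trans (fromℚᵘ-cong {mkℚᵘ (+ (m ℕ.+ n)) 0} {mkℚᵘ (+ m) 0 ℚᵘ.+ mkℚᵘ (+ n) 0} (*≡* num-eq))
        (fromℚᵘ-homo-+ (mkℚᵘ (+ m) 0) (mkℚᵘ (+ n) 0))
  where
  num-eq : + (m ℕ.+ n) ℤ.* + 1 ≡ (+ m ℤ.* + 1 ℤ.+ + n ℤ.* + 1) ℤ.* + 1
  num-eq = cong (ℤ._* + 1)
    (trans (ℤ.pos-+ m n) (sym (cong₂ ℤ._+_ (ℤ.*-identityʳ (+ m)) (ℤ.*-identityʳ (+ n)))))

-- + a / suc d is definitionally fromℚᵘ (mkℚᵘ (+ a) d).
fromℕ*[a/d]≡fromℕ : ∀ u a x d .{{_ : NonZero d}} → u ℕ.* a ≡ x ℕ.* d → fromℕ u * (+ a / d) ≡ fromℕ x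
fromℕ*[a/d]≡fromℕ u a x (suc d) eq = trans (sym (fromℚᵘ-homo-* (mkℚᵘ (+ u) 0) (mkℚᵘ (+ a) d)))
  (fromℚᵘ-cong {mkℚᵘ (+ u) 0 ℚᵘ.* mkℚᵘ (+ a) d} {mkℚᵘ (+ x) 0} (*≡* num-eq))
  where
  num-eq : (+ u ℤ.* + a) ℤ.* + 1 ≡ + x ℤ.* + (1 ℕ.* suc d)
  num-eq = begin
    (+ u ℤ.* + a) ℤ.* + 1 ≡⟨ ℤ.*-identityʳ _ ⟩
    + u ℤ.* + a           ≡⟨ ℤ.pos-* u a ⟨
    + (u ℕ.* a)           ≡⟨ cong +_ eq ⟩
    + (x ℕ.* suc d)       ≡⟨ cong (λ k → + (x ℕ.* k)) (ℕ.*-identityˡ (suc d)) ⟨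
    + (x ℕ.* (1 ℕ.* suc d)) ≡⟨ ℤ.pos-* x _ ⟩
    + x ℤ.* + (1 ℕ.* suc d) ∎

fromℕ-homo-* : ∀ m n → fromℕ (m ℕ.* n) ≡ fromℕ m * fromℕ n
fromℕ-homo-* m n = sym (fromℕ*[a/d]≡fromℕ m n (m ℕ.* n) 1 (sym (ℕ.*-identityʳ (m ℕ.* n))))

fromℕ*factQuot : ∀ u x a b c d → u ℕ.* a ! ≡ x ℕ.* ((b ! ℕ.* c !) ℕ.* d !) →
                 fromℕ u * factQuot a b c d ≡ fromℕ x
fromℕ*factQuot u x a b c d = fromℕ*[a/d]≡fromℕ u (a !) x ((b ! ℕ.* c !) ℕ.* d !) {{nonZero}}
  where
  nonZero : NonZero ((b ! ℕ.* c !) ℕ.* d !)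
  nonZero = ℕ.m*n≢0 (b ! ℕ.* c !) (d !) {{ℕ.m*n≢0 (b !) (c !) {{b ℕ.!≢0}} {{c ℕ.!≢0}}}} {{d ℕ.!≢0}}

sumTo-cong : ∀ q {f g} → (∀ r → r ≤ q → f r ≡ g r) → sumTo q f ≡ sumTo q g
sumTo-cong zero    f≗g = f≗g 0 ℕ.z≤n
sumTo-cong (suc q) f≗g =
  cong₂ _+_ (sumTo-cong q λ r r≤q → f≗g r (ℕ.m≤n⇒m≤1+n r≤q)) (f≗g (suc q) ℕ.≤-refl)

sumTo-fromℕ : ∀ q g → sumTo q (λ r → fromℕ (g r)) ≡ fromℕ (∑< (suc q) g)
sumTo-fromℕ zero    g = refl
sumTo-fromℕ (suc q) g =
  trans (cong (_+ fromℕ (g (suc q))) (sumTo-fromℕ q g)) (sym (fromℕ-homo-+ (∑< (suc q) g) (g (suc q))))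

*-distribˡ-sumTo : ∀ c q f → c * sumTo q f ≡ sumTo q (λ r → c * f r)
*-distribˡ-sumTo c zero    f = refl
*-distribˡ-sumTo c (suc q) f =
  trans (*-distribˡ-+ c (sumTo q f) (f (suc q))) (cong (_+ c * f (suc q)) (*-distribˡ-sumTo c q f))

r≤⌊n/2⌋⇒2r≤n : ∀ {n r} → r ≤ ⌊ n /2⌋ → 2 ℕ.* r ≤ n
r≤⌊n/2⌋⇒2r≤n {n} r≤ = ℕ.≤-trans (ℕ.*-monoʳ-≤ 2 r≤) (2*⌊n/2⌋≤n n)

motzkin≡Mot : ∀ n → motzkin n ≡ fromℕ (Mot n 0)
motzkin≡Mot n = begin
  sumTo (n ℕ./ 2) term
    ≡⟨ cong (λ q → sumTo q term) (n/2≡⌊n/2⌋ n) ⟩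
  sumTo ⌊ n /2⌋ term
    ≡⟨ sumTo-cong ⌊ n /2⌋ count-term ⟩
  sumTo ⌊ n /2⌋ (λ r → fromℕ ((n C (2 ℕ.* r)) ℕ.* Dyck (2 ℕ.* r) 0))
    ≡⟨ sumTo-fromℕ ⌊ n /2⌋ (λ r → (n C (2 ℕ.* r)) ℕ.* Dyck (2 ℕ.* r) 0) ⟩
  fromℕ (∑< (suc ⌊ n /2⌋) (λ r → (n C (2 ℕ.* r)) ℕ.* Dyck (2 ℕ.* r) 0))
    ≡⟨ cong fromℕ (Mot₀≡∑C*Dyck-even n) ⟨
  fromℕ (Mot n 0) ∎
  where
  term : ℕ → ℚ
  term r = factQuot n (n ∸ 2 ℕ.* r) r (r ℕ.+ 1)
  count-term : ∀ r → r ≤ ⌊ n /2⌋ → term r ≡ fromℕ ((n C (2 ℕ.* r)) ℕ.* Dyck (2 ℕ.* r) 0)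
  count-term r r≤ = trans (sym (*-identityˡ (term r)))
    (fromℕ*factQuot 1 ((n C (2 ℕ.* r)) ℕ.* Dyck (2 ℕ.* r) 0) n (n ∸ 2 ℕ.* r) r (r ℕ.+ 1)
      (sym (C*Dyck*factorials≡[1+h]*m! {n} {r} 0 (r≤⌊n/2⌋⇒2r≤n r≤))))

2[1+n]motzkinAssoc₂≡Mot : ∀ n → ((+ 2) / 1) * (((+ suc n) / 1) * motzkinAssoc 2 n) ≡ fromℕ (Mot (suc n) 1)
2[1+n]motzkinAssoc₂≡Mot n = begin
  fromℕ 2 * (fromℕ (suc n) * sumTo (n ℕ./ 2) term)
    ≡⟨ *-assoc (fromℕ 2) (fromℕ (suc n)) _ ⟨
  fromℕ 2 * fromℕ (suc n) * sumTo (n ℕ./ 2) term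
    ≡⟨ cong (_* sumTo (n ℕ./ 2) term) (fromℕ-homo-* 2 (suc n)) ⟨
  fromℕ (2 ℕ.* suc n) * sumTo (n ℕ./ 2) term
    ≡⟨ cong (λ q → fromℕ (2 ℕ.* suc n) * sumTo q term) (n/2≡⌊n/2⌋ n) ⟩
  fromℕ (2 ℕ.* suc n) * sumTo ⌊ n /2⌋ term
    ≡⟨ *-distribˡ-sumTo (fromℕ (2 ℕ.* suc n)) ⌊ n /2⌋ term ⟩
  sumTo ⌊ n /2⌋ (λ r → fromℕ (2 ℕ.* suc n) * term r)
    ≡⟨ sumTo-cong ⌊ n /2⌋ count-term ⟩
  sumTo ⌊ n /2⌋ (λ r → fromℕ (count r))
    ≡⟨ sumTo-fromℕ ⌊ n /2⌋ count ⟩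
  fromℕ (∑< (suc ⌊ n /2⌋) count)
    ≡⟨ cong fromℕ (Mot₁≡∑C*Dyck-odd n) ⟨
  fromℕ (Mot (suc n) 1) ∎
  where
  term : ℕ → ℚ
  term r = factQuot n (n ∸ 2 ℕ.* r) r (r ℕ.+ 2)
  count : ℕ → ℕ
  count r = (suc n C suc (2 ℕ.* r)) ℕ.* Dyck (suc (2 ℕ.* r)) 1
  count-term : ∀ r → r ≤ ⌊ n /2⌋ → fromℕ (2 ℕ.* suc n) * term r ≡ fromℕ (count r)
  count-term r r≤ = fromℕ*factQuot (2 ℕ.* suc n) (count r) n (n ∸ 2 ℕ.* r) r (r ℕ.+ 2)
    (trans (ℕ.*-assoc 2 (suc n) (n !))
           (sym (C*Dyck*factorials≡[1+h]*m! {suc n} {r} 1 (s≤s (r≤⌊n/2⌋⇒2r≤n r≤)))))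

mainTheorem5 : (n : ℕ) →
    sumTo n (λ s → motzkin (n ∸ s) * motzkin s) ≡ ((+ 2) / 1) * (((+ suc n) / 1) * motzkinAssoc 2 n)
mainTheorem5 n = begin
  sumTo n (λ s → motzkin (n ∸ s) * motzkin s)
    ≡⟨ sumTo-cong n (λ s _ → product s) ⟩
  sumTo n (λ s → fromℕ (Mot s 0 ℕ.* Mot (n ∸ s) 0))
    ≡⟨ sumTo-fromℕ n (λ s → Mot s 0 ℕ.* Mot (n ∸ s) 0) ⟩
  fromℕ (∑< (suc n) (λ s → Mot s 0 ℕ.* Mot (n ∸ s) 0))
    ≡⟨ cong fromℕ (Mot-last-visit n 0) ⟨
  fromℕ (Mot (suc n) 1)
    ≡⟨ 2[1+n]motzkinAssoc₂≡Mot n ⟨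
  ((+ 2) / 1) * (((+ suc n) / 1) * motzkinAssoc 2 n) ∎
  where
  product : ∀ s → motzkin (n ∸ s) * motzkin s ≡ fromℕ (Mot s 0 ℕ.* Mot (n ∸ s) 0)
  product s = begin
    motzkin (n ∸ s) * motzkin s               ≡⟨ cong₂ _*_ (motzkin≡Mot (n ∸ s)) (motzkin≡Mot s) ⟩
    fromℕ (Mot (n ∸ s) 0) * fromℕ (Mot s 0)   ≡⟨ *-comm (fromℕ (Mot (n ∸ s) 0)) (fromℕ (Mot s 0)) ⟩
    fromℕ (Mot s 0) * fromℕ (Mot (n ∸ s) 0)   ≡⟨ fromℕ-homo-* (Mot s 0) (Mot (n ∸ s) 0) ⟨
    fromℕ (Mot s 0 ℕ.* Mot (n ∸ s) 0)         ∎
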